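{- Let $n\in\mathbb{N}$ and let $C_n\subseteq G_n$ be a construction with $|C_n|=2n$ that is peaceful for $135^\circ$. Let $k$ be the number of slope buckets containing at least one point of $C_n$. Then $k\ge n+1$.
   Context: $G_n=\{(x,y): x,y\in\{1,\dots,n\}\}$; a construction is a subset of $G_n$. A slope bucket is the set of points of $G_n$ lying on a given line of slope $-1$, i.e. a set $\{(x,y)\in G_n: x+y=c\}$. Three distinct points form an angle of $\theta$ if one of the interior angles of the triangle they span equals $\theta$; a construction is peaceful for $\theta$ if no three of its points form an angle of $\theta$. -}

module Defs where

open import Data.Nat as ℕ using (ℕ; _≤_; _*_)
open import Data.Integer as ℤ using (ℤ; +_; _-_; _<_)
open import Data.Product using (_×_; _,_; proj₁; proj₂)
open import Data.List using (List; length; map; deduplicate)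
open import Data.List.Membership.Propositional using (_∈_)
open import Data.List.Relation.Unary.All using (All)
open import Data.List.Relation.Unary.Unique.Propositional using (Unique)
open import Relation.Binary.PropositionalEquality using (_≡_; _≢_)
open import Relation.Nullary using (¬_)

Point : Set
Point = ℕ × ℕ

InGrid : ℕ → Point → Set
InGrid n (x , y) = (1 ≤ x × x ≤ n) × (1 ≤ y × y ≤ n)

record Construction (n : ℕ) : Set where
  field
    pts    : List Point
    unique : Unique pts
    inGrid : All (InGrid n) pts
open Construction public

∣_∣ : ∀ {n} → Construction n → ℕ
∣ C ∣ = length (pts C)

dx dy : Point → Point → ℤ
dx (x₁ , _) (x₂ , _) = + x₁ - + x₂
dy (_ , y₁) (_ , y₂) = + y₁ - + y₂

dot : Point → Point → Point → ℤ
dot A B C = dx A B ℤ.* dx C B ℤ.+ dy A B ℤ.* dy C B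

sqLen : Point → Point → ℤ
sqLen A B = dx A B ℤ.* dx A B ℤ.+ dy A B ℤ.* dy A B

-- The angle ∠ABC (at vertex B, between nonzero vectors u = A-B, v = C-B)
-- equals 135°  iff  cos ∠ABC = -1/√2  iff  u·v < 0 and 2 (u·v)² = |u|²|v|².
Angle135At : Point → Point → Point → Set
Angle135At A B C =
  (dot A B C < + 0) × (+ 2 ℤ.* (dot A B C ℤ.* dot A B C) ≡ sqLen A B ℤ.* sqLen C B)

-- Peaceful for 135°: no three distinct points of the construction have an
-- interior angle of 135° (quantifying over all ordered triples covers every
-- choice of vertex).
Peaceful135 : ∀ {n} → Construction n → Set
Peaceful135 C = ∀ {A B D} → A ∈ pts C → B ∈ pts C → D ∈ pts C →
  A ≢ B → B ≢ D → A ≢ D → ¬ Angle135At A B D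

-- The slope bucket of a point (x , y) is determined by c = x + y.
bucketIndex : Point → ℕ
bucketIndex (x , y) = x ℕ.+ y

numBuckets : ∀ {n} → Construction n → ℕ
numBuckets C = length (deduplicate ℕ._≟_ (map bucketIndex (pts C)))

module Submission where

-- In every slope bucket order the points of C by x. A point Q that is not the leftmost one of its
-- bucket has a bucketmate P up and to its left, and a point R of C to the right of Q in Q's row would
-- give ∠PQR = 135°. So a non-leftmost point is the rightmost point of its row, and it lies strictly
-- below P, hence in one of the rows 1, …, n − 1. Labelling each leftmost point by its bucket and every
-- other point by its row is therefore injective, and 2n = |C| ≤ k + (n − 1).

open import Defs
open import Data.Nat as ℕ using (ℕ; _≤_; _*_; _+_; suc; pred; _<_; _≟_; _<?_; s≤s; z≤n)
open import Data.Nat.Properties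
  using (<-cmp; <-irrefl; <-trans; <-≤-trans; <⇒≤; <⇒≤pred; ≮⇒≥; m<n⇒0<n∸m; +-mono-<-≤;
         +-cancelˡ-≡; +-cancelʳ-≤; module ≤-Reasoning)
import Data.Nat.Tactic.RingSolver as ℕ-Ring
open import Data.Integer as ℤ using (ℤ; +_; _-_; 0ℤ; -_; +<+; positive)
open import Data.Integer.Properties
  using (pos-+; [+m]-[+n]≡m⊖n; ≤-⊖; +-inverseʳ; *-monoˡ-<-pos; neg-mono-<)
open import Data.Integer.Tactic.RingSolver using (solve-∀)
open import Data.Product using (_×_; _,_; proj₁; proj₂)
open import Data.Sum using (_⊎_; inj₁; inj₂)
open import Data.Sum.Properties using (inj₁-injective; inj₂-injective)
open import Data.Empty using (⊥; ⊥-elim)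
open import Function using (_∘_)
open import Data.List using (List; []; _∷_; length; map; deduplicate; applyUpTo; _++_)
open import Data.List.Properties using (length-++; length-map; length-applyUpTo; length-removeAt′)
open import Data.List.Membership.Propositional using (_∈_; find; lose)
open import Data.List.Membership.Propositional.Properties
  using (∈-map⁺; ∈-++⁺ˡ; ∈-++⁺ʳ; ∈-applyUpTo⁺; ∈-deduplicate⁺)
open import Data.List.Relation.Unary.Any using (here; there; any?; _─_; index)
import Data.List.Relation.Unary.All as All
open import Data.List.Relation.Unary.AllPairs using (_∷_)
open import Data.List.Relation.Unary.Unique.Propositional using (Unique)
open import Relation.Binary using (tri<; tri≈; tri>)
open import Relation.Binary.PropositionalEquality
  using (_≡_; _≢_; refl; sym; trans; cong; cong₂; subst₂; module ≡-Reasoning)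
open import Relation.Nullary using (Dec; yes; no)
open import Relation.Nullary.Decidable using (_×-dec_)

∈-─⁺ : ∀ {A : Set} {x y : A} {ys : List A} (x∈ys : x ∈ ys) → y ∈ ys → y ≢ x → y ∈ (ys ─ x∈ys)
∈-─⁺ (here refl)  (here refl)  y≢x = ⊥-elim (y≢x refl)
∈-─⁺ (here _)     (there y∈ys) _   = y∈ys
∈-─⁺ (there _)    (here refl)  _   = here refl
∈-─⁺ (there x∈ys) (there y∈ys) y≢x = there (∈-─⁺ x∈ys y∈ys y≢x)

length-≤-injectiveOn : ∀ {A B : Set} (f : A → B) {xs : List A} {ys : List B} → Unique xs →
  (∀ {a b} → a ∈ xs → b ∈ xs → f a ≡ f b → a ≡ b) → (∀ {a} → a ∈ xs → f a ∈ ys) →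
  length xs ≤ length ys
length-≤-injectiveOn f {[]}     _                _   _    = z≤n
length-≤-injectiveOn f {x ∷ xs} {ys} (x∉xs ∷ unique) inj maps = begin
  suc (length xs)           ≤⟨ s≤s (length-≤-injectiveOn f unique (λ a b → inj (there a) (there b)) maps′) ⟩
  suc (length (ys ─ fx∈ys)) ≡⟨ sym (length-removeAt′ ys (index fx∈ys)) ⟩
  length ys                 ∎
  where
  open ≤-Reasoning
  fx∈ys : f x ∈ ys
  fx∈ys = maps (here refl)
  maps′ : ∀ {a} → a ∈ xs → f a ∈ (ys ─ fx∈ys)
  maps′ a∈xs = ∈-─⁺ fx∈ys (maps (there a∈xs))
    (λ fa≡fx → All.lookup x∉xs a∈xs (sym (inj (there a∈xs) (here refl) fa≡fx)))

∈-applyUpTo∘suc⁺ : ∀ {A : Set} (f : ℕ → A) {m n} → 1 ≤ m → m < n → f m ∈ applyUpTo (f ∘ suc) (pred n)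
∈-applyUpTo∘suc⁺ f {suc m} _ 1+m<n = ∈-applyUpTo⁺ (f ∘ suc) (<⇒≤pred 1+m<n)

m<n⇒0<[+n]-[+m] : ∀ {m n} → m < n → 0ℤ ℤ.< + n - + m
m<n⇒0<[+n]-[+m] {m} {n} m<n = subst₂ ℤ._<_ refl (sym n-m≡n∸m) (+<+ (m<n⇒0<n∸m m<n))
  where
  n-m≡n∸m : + n - + m ≡ + (n ℕ.∸ m)
  n-m≡n∸m = trans ([+m]-[+n]≡m⊖n n m) (≤-⊖ (<⇒≤ m<n))

sameBucket⇒dx≡-dy : ∀ {A B} → bucketIndex A ≡ bucketIndex B → dx A B ≡ - dy A B
sameBucket⇒dx≡-dy {x₁ , y₁} {x₂ , y₂} same = begin
  + x₁ - + x₂                   ≡⟨ shift (+ x₁) (+ y₁) (+ x₂) ⟩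
  (+ x₁ ℤ.+ + y₁) - + x₂ - + y₁ ≡⟨ cong (λ s → s - + x₂ - + y₁) same-ℤ ⟩
  (+ x₂ ℤ.+ + y₂) - + x₂ - + y₁ ≡⟨ unshift (+ x₂) (+ y₂) (+ y₁) ⟩
  - (+ y₁ - + y₂)               ∎
  where
  open ≡-Reasoning
  same-ℤ : + x₁ ℤ.+ + y₁ ≡ + x₂ ℤ.+ + y₂
  same-ℤ = trans (sym (pos-+ x₁ y₁)) (trans (cong +_ same) (pos-+ x₂ y₂))
  shift : ∀ a b c → a - c ≡ (a ℤ.+ b) - c - b
  shift = solve-∀
  unshift : ∀ c d b → (c ℤ.+ d) - c - b ≡ - (b - d)
  unshift = solve-∀

sameBucket-leftOf⇒above : ∀ {P Q} → bucketIndex P ≡ bucketIndex Q → proj₁ P < proj₁ Q →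
  proj₂ Q < proj₂ P
sameBucket-leftOf⇒above {xP , yP} {xQ , yQ} same xP<xQ with yQ <? yP
... | yes yQ<yP = yQ<yP
... | no  yQ≮yP = ⊥-elim (<-irrefl same (+-mono-<-≤ xP<xQ (≮⇒≥ yQ≮yP)))

-- The conclusion is Angle135At for u = (a , b) = (−b , b) along a bucket and v = (c , d) = (c , 0)
-- along a row.
angle135-diagonal-horizontal : ∀ {a b c d : ℤ} → a ≡ - b → d ≡ 0ℤ → 0ℤ ℤ.< b → 0ℤ ℤ.< c →
  (a ℤ.* c ℤ.+ b ℤ.* d ℤ.< 0ℤ) ×
  (+ 2 ℤ.* ((a ℤ.* c ℤ.+ b ℤ.* d) ℤ.* (a ℤ.* c ℤ.+ b ℤ.* d)) ≡ (a ℤ.* a ℤ.+ b ℤ.* b) ℤ.* (c ℤ.* c ℤ.+ d ℤ.* d))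
angle135-diagonal-horizontal {b = b} {c} refl refl 0<b 0<c = u·v<0 , squares b c
  where
  squares : ∀ b c → + 2 ℤ.* ((- b ℤ.* c ℤ.+ b ℤ.* 0ℤ) ℤ.* (- b ℤ.* c ℤ.+ b ℤ.* 0ℤ))
                  ≡ (- b ℤ.* - b ℤ.+ b ℤ.* b) ℤ.* (c ℤ.* c ℤ.+ 0ℤ ℤ.* 0ℤ)
  squares = solve-∀
  u·v≡-bc : ∀ b c → - b ℤ.* c ℤ.+ b ℤ.* 0ℤ ≡ - (b ℤ.* c)
  u·v≡-bc = solve-∀
  -[b*0]≡0 : ∀ b → - (b ℤ.* 0ℤ) ≡ 0ℤ
  -[b*0]≡0 = solve-∀
  u·v<0 : - b ℤ.* c ℤ.+ b ℤ.* 0ℤ ℤ.< 0ℤ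
  u·v<0 = subst₂ ℤ._<_ (sym (u·v≡-bc b c)) (-[b*0]≡0 b)
    (neg-mono-< (*-monoˡ-<-pos b {{positive 0<b}} 0<c))

bucket-row⇒Angle135At : ∀ {P Q R} → bucketIndex P ≡ bucketIndex Q → proj₁ P < proj₁ Q →
  proj₂ R ≡ proj₂ Q → proj₁ Q < proj₁ R → Angle135At P Q R
bucket-row⇒Angle135At {P} {Q} same xP<xQ refl xQ<xR =
  angle135-diagonal-horizontal (sameBucket⇒dx≡-dy {P} {Q} same) (+-inverseʳ (+ proj₂ Q))
    (m<n⇒0<[+n]-[+m] (sameBucket-leftOf⇒above same xP<xQ)) (m<n⇒0<[+n]-[+m] xQ<xR)

x<⇒≢ : ∀ {P Q : Point} → proj₁ P < proj₁ Q → P ≢ Q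
x<⇒≢ xP<xQ P≡Q = <-irrefl (cong proj₁ P≡Q) xP<xQ

LeftBucketmate : Point → Point → Set
LeftBucketmate Q P = bucketIndex P ≡ bucketIndex Q × proj₁ P < proj₁ Q

leftBucketmate? : ∀ Q P → Dec (LeftBucketmate Q P)
leftBucketmate? Q P = (bucketIndex P ≟ bucketIndex Q) ×-dec (proj₁ P <? proj₁ Q)

label : List Point → Point → ℕ ⊎ ℕ
label L Q with any? (leftBucketmate? Q) L
... | yes _ = inj₂ (proj₂ Q)
... | no  _ = inj₁ (bucketIndex Q)

module _ {n : ℕ} (C : Construction n) where

  Peaceful135⇒¬bucket-row-corner : Peaceful135 C → ∀ {P Q R} → P ∈ pts C → Q ∈ pts C → R ∈ pts C →
    LeftBucketmate Q P → proj₂ R ≡ proj₂ Q → proj₁ Q < proj₁ R → ⊥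
  Peaceful135⇒¬bucket-row-corner peace P∈C Q∈C R∈C (same , xP<xQ) row xQ<xR =
    peace P∈C Q∈C R∈C (x<⇒≢ xP<xQ) (x<⇒≢ xQ<xR) (x<⇒≢ (<-trans xP<xQ xQ<xR))
      (bucket-row⇒Angle135At same xP<xQ row xQ<xR)

  label-injectiveOn : Peaceful135 C → ∀ {a b} → a ∈ pts C → b ∈ pts C →
    label (pts C) a ≡ label (pts C) b → a ≡ b
  label-injectiveOn peace {a} {b} a∈C b∈C eq
    with any? (leftBucketmate? a) (pts C) | any? (leftBucketmate? b) (pts C)
  label-injectiveOn peace a∈C b∈C () | yes _ | no _
  label-injectiveOn peace a∈C b∈C () | no _  | yes _
  label-injectiveOn peace {xa , ya} {xb , yb} a∈C b∈C eq | no a-leftmost | no b-leftmost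
    with same ← inj₁-injective eq | <-cmp xa xb
  ... | tri< xa<xb _ _ = ⊥-elim (b-leftmost (lose a∈C (same , xa<xb)))
  ... | tri> _ _ xb<xa = ⊥-elim (a-leftmost (lose b∈C (sym same , xb<xa)))
  ... | tri≈ _ refl _  = cong (xa ,_) (+-cancelˡ-≡ xa ya yb same)
  label-injectiveOn peace {xa , ya} {xb , yb} a∈C b∈C eq | yes a-mate | yes b-mate
    with refl ← inj₂-injective eq | <-cmp xa xb
  ... | tri≈ _ refl _  = refl
  ... | tri< xa<xb _ _ = let _ , P∈C , P-mate = find a-mate in
    ⊥-elim (Peaceful135⇒¬bucket-row-corner peace P∈C a∈C b∈C P-mate refl xa<xb)
  ... | tri> _ _ xb<xa = let _ , P∈C , P-mate = find b-mate in
    ⊥-elim (Peaceful135⇒¬bucket-row-corner peace P∈C b∈C a∈C P-mate refl xb<xa)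

  buckets : List ℕ
  buckets = deduplicate _≟_ (map bucketIndex (pts C))

  labels : List (ℕ ⊎ ℕ)
  labels = map inj₁ buckets ++ applyUpTo (inj₂ ∘ suc) (pred n)

  length-labels : length labels ≡ numBuckets C + pred n
  length-labels = trans (length-++ (map inj₁ buckets))
    (cong₂ _+_ (length-map inj₁ buckets) (length-applyUpTo (inj₂ ∘ suc) (pred n)))

  label∈labels : ∀ {a} → a ∈ pts C → label (pts C) a ∈ labels
  label∈labels {a} a∈C with any? (leftBucketmate? a) (pts C)
  ... | no _ = ∈-++⁺ˡ (∈-map⁺ inj₁ (∈-deduplicate⁺ _≟_ (∈-map⁺ bucketIndex a∈C)))
  ... | yes a-mate
    with P , P∈C , (same , xP<xa) ← find a-mate
    with _ , (1≤ya , _) ← All.lookup (inGrid C) a∈C | _ , (_ , yP≤n) ← All.lookup (inGrid C) P∈C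
    = ∈-++⁺ʳ _ (∈-applyUpTo∘suc⁺ inj₂ 1≤ya (<-≤-trans (sameBucket-leftOf⇒above same xP<xa) yP≤n))

2n≤k+pred[n]⇒n+1≤k : ∀ {n k} → 1 ≤ n → 2 * n ≤ k + pred n → n + 1 ≤ k
2n≤k+pred[n]⇒n+1≤k {suc m} {k} _ 2n≤k+m = +-cancelʳ-≤ m (suc m + 1) k (begin
  suc m + 1 + m ≡⟨ regroup m ⟩
  2 * suc m     ≤⟨ 2n≤k+m ⟩
  k + m         ∎)
  where
  open ≤-Reasoning
  regroup : ∀ m → suc m + 1 + m ≡ 2 * suc m
  regroup = ℕ-Ring.solve-∀

lemma8 : (n : ℕ) → 1 ≤ n → (C : Construction n) → ∣ C ∣ ≡ 2 * n →
         Peaceful135 C → n + 1 ≤ numBuckets C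
lemma8 n 1≤n C ∣C∣≡2n peace = 2n≤k+pred[n]⇒n+1≤k 1≤n (begin
  2 * n                 ≡⟨ sym ∣C∣≡2n ⟩
  length (pts C)        ≤⟨ length-≤-injectiveOn (label (pts C)) (unique C)
                             (label-injectiveOn C peace) (label∈labels C) ⟩
  length (labels C)     ≡⟨ length-labels C ⟩
  numBuckets C + pred n ∎)
  where open ≤-Reasoning
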